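{- Let $\mathbb{F}$ be a field, $A\in\mathbb{F}^{n\times n}$, $Z$ a zero forcing set of $A$ with a fixed chronological list of forces $\pi$ and terminal set $T$, and let $B\in\mathbb{F}^{T\times Z}$ be the core matrix of $A$. Let $b\in\mathbb{F}^n$ be such that $Ax=b$ has at least one solution. If $y\in\mathbb{F}^Z$ satisfies $By=R(b)_T$, then there exists $x\in\mathbb{F}^n$ with $Ax=b$ and $x_Z=y$.
   Context: Let $G=(V,E)$, $V=[n]$, be the directed graph with $(u,v)\in E$ iff $u\neq v$ and $A_{u,v}\neq0$. Zero forcing: starting from a blue set $Z$, a blue vertex with exactly one non-blue out-neighbour $u$ forces $u$ (colours it blue); $Z$ is a zero forcing set if this eventually colours all of $V$ blue. A chronological list of forces $\pi$ is an ordering $u_1,\dots,u_{n-|Z|}$ of $V\setminus Z$ together with, for each $u_i$, a forcing parent $u_i^{\uparrow}\in Z\cup\{u_1,\dots,u_{i-1}\}$ such that $u_i$ is the only out-neighbour of $u_i^{\uparrow}$ outside $Z\cup\{u_1,\dots,u_{i-1}\}$ (so $A_{u_i^{\uparrow},u_i}\neq0$). A vertex is a terminal if it is the forcing parent of no vertex; $T$ is the set of terminals (and $|T|=|Z|$). The procedure $\textsc{Forcing}(A,Z,b)$: set $x\gets0$; for each $u\in V\setminus Z$ in the order $\pi$, set $x_u\gets (b_{u^{\uparrow}}-A_{u^{\uparrow},*}x)/A_{u^{\uparrow},u}$, where $A_{w,*}$ is row $w$ of $A$; return $x$. Let $R(b)=b-A\,\textsc{Forcing}(A,Z,b)$, a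 linear map. The core matrix of $A$ is $B=(RA)_{T,Z}$, i.e. the matrix with rows indexed by $T$, columns indexed by $Z$, whose column $v\in Z$ is $R(a_v)_T$ where $a_v$ is the $v$-th column of $A$. For a vector $w$ and index set $I$, $w_I$ is the restriction of $w$ to $I$. -}

module Defs where

open import Level using (Level; _⊔_) renaming (suc to lsuc)
open import Algebra.Bundles using (CommutativeRing)
open import Data.Nat using (ℕ; zero; suc)
open import Data.Fin using (Fin; zero; suc; _≟_)
open import Data.Fin.Subset using (Subset; _∈_; _∉_; _∪_; ⁅_⁆)
open import Data.Vec using (lookup)
open import Data.Bool using (Bool; true; false; if_then_else_)
open import Data.Product using (_×_; _,_; proj₁; ∃)
open import Data.List using (List; []; _∷_; map)
import Data.List.Membership.Propositional as LM
open import Relation.Nullary using (¬_; does)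
open import Relation.Binary.PropositionalEquality using (_≡_; _≢_)

record Field (c ℓ : Level) : Set (lsuc (c ⊔ ℓ)) where
  field
    commutativeRing : CommutativeRing c ℓ
  open CommutativeRing commutativeRing public
  field
    1≉0      : ¬ (1# ≈ 0#)
    inv      : (x : Carrier) → ¬ (x ≈ 0#) → Carrier
    inverseʳ : (x : Carrier) (nz : ¬ (x ≈ 0#)) → (x * inv x nz) ≈ 1#

module _ {c ℓ : Level} (F : Field c ℓ) where
  open Field F using (Carrier; _≈_; _+_; _*_; _-_; 0#; inv)

  Σ : (n : ℕ) → (Fin n → Carrier) → Carrier
  Σ zero    f = 0#
  Σ (suc n) f = f zero + Σ n (λ i → f (suc i))

  Matrix : ℕ → Set c
  Matrix n = Fin n → Fin n → Carrier

  VecF : ℕ → Set c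
  VecF n = Fin n → Carrier

  mulV : {n : ℕ} → Matrix n → VecF n → VecF n
  mulV {n} A x i = Σ n (λ j → A i j * x j)

  -- A chronological list of forces, starting from the blue set `blue`:
  -- a list of pairs (forcing parent , forced vertex), in order.
  -- A step (p , u) requires: p blue, u not blue, (p,u) an edge (A p u ≠ 0,
  -- p ≠ u automatic), and u the only non-blue out-neighbour of p.
  -- At the end all vertices must be blue (so the start set is zero forcing).
  data Chron {n : ℕ} (A : Matrix n) (blue : Subset n) : List (Fin n × Fin n) → Set (c ⊔ ℓ) where
    done : (∀ v → v ∈ blue) → Chron A blue []
    step : ∀ {p u π}
         → p ∈ blue
         → u ∉ blue
         → (nz : ¬ (A p u ≈ 0#))
         → (∀ w → w ∉ blue → w ≢ u → A p w ≈ 0#)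
         → Chron A (⁅ u ⁆ ∪ blue) π
         → Chron A blue ((p , u) ∷ π)

  Terminal : {n : ℕ} → List (Fin n × Fin n) → Fin n → Set
  Terminal π v = ¬ (v LM.∈ map proj₁ π)

  forcingFrom : {n : ℕ} {A : Matrix n} {blue : Subset n} {π : List (Fin n × Fin n)}
              → Chron A blue π → VecF n → VecF n → VecF n
  forcingFrom (done _) b x = x
  forcingFrom {n} {A} (step {p} {u} _ _ nz _ rest) b x =
    forcingFrom rest b (λ j → if does (j ≟ u) then val else x j)
    where
    val : Carrier
    val = (b p - mulV A x p) * inv (A p u) nz

  Forcing : {n : ℕ} {A : Matrix n} {Z : Subset n} {π : List (Fin n × Fin n)}
          → Chron A Z π → VecF n → VecF n
  Forcing ch b = forcingFrom ch b (λ _ → 0#)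

  Res : {n : ℕ} {A : Matrix n} {Z : Subset n} {π : List (Fin n × Fin n)}
      → Chron A Z π → VecF n → VecF n
  Res {A = A} ch b i = b i - mulV A (Forcing ch b) i

  -- Core matrix entry B_{v,w} = R(a_w)_v (meaningful for v ∈ T, w ∈ Z).
  core : {n : ℕ} {A : Matrix n} {Z : Subset n} {π : List (Fin n × Fin n)}
       → Chron A Z π → Fin n → Fin n → Carrier
  core {A = A} ch v w = Res ch (λ i → A i w) v

  coreMul : {n : ℕ} {A : Matrix n} {Z : Subset n} {π : List (Fin n × Fin n)}
          → Chron A Z π → VecF n → Fin n → Carrier
  coreMul {n} {Z = Z} ch y v =
    Σ n (λ w → if lookup Z w then core ch v w * y w else 0#)

{-# OPTIONS --safe #-}
-- The forcing procedure is linear in the pair (b, x) and never changes a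
-- coordinate that is already blue.  Let y₀ be y on Z and 0 off Z.  Forcing
-- A y₀ from y₀ just reproduces y₀, so the vector x forced from y₀ splits as
-- y₀ + Forcing(b - A y₀), whence A x = b - R(b - A y₀).  The residual R
-- vanishes on every forcing parent p, because forcing the child of p solves
-- row p and later forces never touch the support of that row; on a
-- terminal v, R(b - A y₀)_v = R(b)_v - (B y)_v = 0 by linearity of R and
-- the definition of the core matrix.  Hence A x = b and x_Z = y.
module Submission where

open import Defs
open import Level using (Level)
open import Data.Nat using (ℕ; zero; suc)
open import Data.Fin using (Fin; zero; suc; _≟_; punchIn)
open import Data.Fin.Properties using (punchInᵢ≢i)
open import Data.Fin.Subset using (Subset; _∈_; _∉_; _∪_; ⁅_⁆)
open import Data.Fin.Subset.Properties using (x∈p∪q⁻; x∈p∪q⁺; x∈⁅x⁆; x∈⁅y⁆⇒x≡y; _∈?_)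
open import Data.Vec using (lookup)
open import Data.Vec.Properties using ([]=⇒lookup; lookup⇒[]=)
open import Data.Bool using (true; false; if_then_else_)
open import Data.Product using (_×_; ∃; _,_; proj₁; proj₂)
open import Data.Sum using (inj₁; inj₂)
open import Data.List using (List; map)
open import Data.List.Relation.Unary.Any using (here; there)
import Data.List.Membership.Propositional as List
open import Function using (_∘_)
open import Relation.Nullary using (¬_; does; yes; no; contradiction)
open import Relation.Binary.PropositionalEquality using (_≡_; _≢_; refl; cong; cong₂)

module Properties {c ℓ : Level} (F : Field c ℓ) where
  open Field F hiding (zero) renaming (refl to ≈-refl)
  open import Algebra.Properties.Ring ring using (-1*x≈-x; x[y-z]≈xy-xz; -‿+-comm)
  open import Algebra.Properties.AbelianGroup +-abelianGroup
    using (//-rightDividesˡ; //-rightDividesʳ; x∙y⁻¹≈ε⇒x≈y; x≈y⇒x∙y⁻¹≈ε)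
  open import Algebra.Properties.CommutativeSemigroup +-commutativeSemigroup
    using (interchange)
  open import Algebra.Properties.CommutativeSemigroup *-commutativeSemigroup
    using (x∙yz≈y∙xz)
  open import Algebra.Properties.Semiring.Sum semiring
    using (sum; sum-cong-≋; ∑-distrib-+; *-distribˡ-sum; sum-remove; sum-replicate-zero)
  open import Relation.Binary.Reasoning.Setoid setoid

  x*[y*x⁻¹]≈y : ∀ x y (x≉0 : ¬ x ≈ 0#) → x * (y * inv x x≉0) ≈ y
  x*[y*x⁻¹]≈y x y x≉0 = begin
    x * (y * inv x x≉0) ≈⟨ x∙yz≈y∙xz x y _ ⟩
    y * (x * inv x x≉0) ≈⟨ *-congˡ (inverseʳ x x≉0) ⟩
    y * 1#              ≈⟨ *-identityʳ y ⟩
    y                   ∎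

  [x*y]*x⁻¹≈y : ∀ x y (x≉0 : ¬ x ≈ 0#) → (x * y) * inv x x≉0 ≈ y
  [x*y]*x⁻¹≈y x y x≉0 = trans (*-assoc x y _) (x*[y*x⁻¹]≈y x y x≉0)

  -‿linear : ∀ α a b c d → (α * a + b) - (α * c + d) ≈ α * (a - c) + (b - d)
  -‿linear α a b c d = begin
    (α * a + b) - (α * c + d)       ≈⟨ +-congˡ (-‿+-comm (α * c) d) ⟨
    (α * a + b) + (- (α * c) + - d) ≈⟨ interchange (α * a) b (- (α * c)) (- d) ⟩
    (α * a - α * c) + (b - d)       ≈⟨ +-congʳ (x[y-z]≈xy-xz α a c) ⟨
    α * (a - c) + (b - d)           ∎

  -1*x+x≈0 : ∀ x → - 1# * x + x ≈ 0#
  -1*x+x≈0 x = trans (+-congʳ (-1*x≈-x x)) (-‿inverseˡ x)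

  x≈1*x+0 : ∀ x → x ≈ 1# * x + 0#
  x≈1*x+0 x = sym (trans (+-identityʳ _) (*-identityˡ x))

  0≈α*0+0 : ∀ α → 0# ≈ α * 0# + 0#
  0≈α*0+0 α = sym (trans (+-identityʳ _) (zeroʳ α))

  Σ≡sum : ∀ n (f : Fin n → Carrier) → Σ F n f ≡ sum f
  Σ≡sum zero    f = refl
  Σ≡sum (suc n) f = cong (f zero +_) (Σ≡sum n (f ∘ suc))

  Σ-cong : ∀ n {f g : Fin n → Carrier} → (∀ i → f i ≈ g i) → Σ F n f ≈ Σ F n g
  Σ-cong n {f} {g} f≈g = begin
    Σ F n f ≡⟨ Σ≡sum n f ⟩
    sum f   ≈⟨ sum-cong-≋ f≈g ⟩
    sum g   ≡⟨ Σ≡sum n g ⟨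
    Σ F n g ∎

  Σ-linear : ∀ n α (f g : Fin n → Carrier) → Σ F n (λ i → α * f i + g i) ≈ α * Σ F n f + Σ F n g
  Σ-linear n α f g = begin
    Σ F n (λ i → α * f i + g i)       ≡⟨ Σ≡sum n _ ⟩
    sum (λ i → α * f i + g i)         ≈⟨ ∑-distrib-+ (λ i → α * f i) g ⟩
    sum (λ i → α * f i) + sum g       ≈⟨ +-congʳ (*-distribˡ-sum α f) ⟨
    α * sum f + sum g                 ≡⟨ cong₂ (λ s t → α * s + t) (Σ≡sum n f) (Σ≡sum n g) ⟨
    α * Σ F n f + Σ F n g             ∎

  Σ-single : ∀ n {f : Fin n → Carrier} (u : Fin n) → (∀ j → j ≢ u → f j ≈ 0#) → Σ F n f ≈ f u
  Σ-single (suc n) {f} u f≈0 = begin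
    Σ F (suc n) f             ≡⟨ Σ≡sum (suc n) f ⟩
    sum f                     ≈⟨ sum-remove {i = u} f ⟩
    f u + sum (f ∘ punchIn u) ≈⟨ +-congˡ (sum-cong-≋ (λ j → f≈0 _ (punchInᵢ≢i u j))) ⟩
    f u + sum {n} (λ _ → 0#)  ≈⟨ +-congˡ (sum-replicate-zero n) ⟩
    f u + 0#                  ≈⟨ +-identityʳ (f u) ⟩
    f u                       ∎

  module _ {n : ℕ} where

    SupportedIn : VecF F n → Subset n → Set ℓ
    SupportedIn x S = ∀ j → j ∉ S → x j ≈ 0#

    update : Fin n → Carrier → VecF F n → VecF F n
    update u v x j = if does (j ≟ u) then v else x j

    restrict : Subset n → VecF F n → VecF F n
    restrict S y j = if lookup S j then y j else 0#

    ∈⁅u⁆∪⁻ : ∀ {j} u (S : Subset n) → j ∈ ⁅ u ⁆ ∪ S → j ≢ u → j ∈ S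
    ∈⁅u⁆∪⁻ u S j∈ j≢u with x∈p∪q⁻ ⁅ u ⁆ S j∈
    ... | inj₁ j∈⁅u⁆ = contradiction (x∈⁅y⁆⇒x≡y u j∈⁅u⁆) j≢u
    ... | inj₂ j∈S  = j∈S

    ∉⁅u⁆∪⁻ : ∀ {j} u (S : Subset n) → j ∉ ⁅ u ⁆ ∪ S → j ≢ u × j ∉ S
    ∉⁅u⁆∪⁻ u S j∉ =
      (λ { refl → j∉ (x∈p∪q⁺ {p = ⁅ u ⁆} {q = S} (inj₁ (x∈⁅x⁆ u))) }) ,
      (λ j∈S → j∉ (x∈p∪q⁺ {p = ⁅ u ⁆} {q = S} (inj₂ j∈S)))

    update-≡ : ∀ u v x → update u v x u ≡ v
    update-≡ u v x with u ≟ u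
    ... | yes _   = refl
    ... | no u≢u = contradiction refl u≢u

    update-≢ : ∀ {j} u v x → j ≢ u → update u v x j ≡ x j
    update-≢ {j} u v x j≢u with j ≟ u
    ... | yes j≡u = contradiction j≡u j≢u
    ... | no _    = refl

    supportedIn-∪ : ∀ {x : VecF F n} {S : Subset n} u → SupportedIn x S → SupportedIn x (⁅ u ⁆ ∪ S)
    supportedIn-∪ {S = S} u x⊆S j j∉ = x⊆S j (proj₂ (∉⁅u⁆∪⁻ u S j∉))

    update-supportedIn : ∀ {x : VecF F n} {S : Subset n} u v →
                         SupportedIn x S → SupportedIn (update u v x) (⁅ u ⁆ ∪ S)
    update-supportedIn {x} {S} u v x⊆S j j∉ =
      trans (reflexive (update-≢ u v x (proj₁ (∉⁅u⁆∪⁻ u S j∉)))) (supportedIn-∪ u x⊆S j j∉)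

    update-agrees : ∀ {x z : VecF F n} {S : Subset n} u {v} → v ≈ z u → (∀ j → j ∈ S → x j ≈ z j) →
                    ∀ j → j ∈ ⁅ u ⁆ ∪ S → update u v x j ≈ z j
    update-agrees {S = S} u v≈zu x≈z j j∈ with j ≟ u
    ... | yes refl = v≈zu
    ... | no j≢u   = x≈z j (∈⁅u⁆∪⁻ u S j∈ j≢u)

    restrict-supportedIn : ∀ S y → SupportedIn (restrict S y) S
    restrict-supportedIn S y j j∉S with lookup S j in eq
    ... | true  = contradiction (lookup⇒[]= j S eq) j∉S
    ... | false = ≈-refl

    restrict-∈ : ∀ {S : Subset n} {j} y → j ∈ S → restrict S y j ≈ y j
    restrict-∈ {S} {j} y j∈S rewrite []=⇒lookup j∈S = ≈-refl

  module _ {n : ℕ} (A : Matrix F n) where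

    open import Data.List.Membership.DecPropositional (_≟_ {n}) using () renaming (_∈?_ to _∈ₗ?_)

    A·_ : VecF F n → VecF F n
    A·_ = mulV F A

    A·-linear : ∀ α {x x₁ x₂ : VecF F n} → (∀ j → x j ≈ α * x₁ j + x₂ j) →
                ∀ i → (A· x) i ≈ α * (A· x₁) i + (A· x₂) i
    A·-linear α {x} {x₁} {x₂} x≈ i = trans (Σ-cong n entry) (Σ-linear n α _ _)
      where
      entry : ∀ j → A i j * x j ≈ α * (A i j * x₁ j) + A i j * x₂ j
      entry j = trans (*-congˡ (x≈ j))
                      (trans (distribˡ (A i j) _ _) (+-congʳ (x∙yz≈y∙xz (A i j) α (x₁ j))))

    A·-cong-on : ∀ {S p} {x x′ : VecF F n} → SupportedIn (A p) S →
                 (∀ j → j ∈ S → x j ≈ x′ j) → (A· x) p ≈ (A· x′) p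
    A·-cong-on {S} {p} {x} {x′} row⊆S x≈x′ = Σ-cong n entry
      where
      entry : ∀ j → A p j * x j ≈ A p j * x′ j
      entry j with j ∈? S
      ... | yes j∈S = *-congˡ (x≈x′ j j∈S)
      ... | no j∉S  = trans (annihilated (x j)) (sym (annihilated (x′ j)))
        where
        annihilated : ∀ t → A p j * t ≈ 0#
        annihilated t = trans (*-congʳ (row⊆S j j∉S)) (zeroˡ t)

    A·-update : ∀ {u} v {x : VecF F n} → x u ≈ 0# → ∀ p → (A· update u v x) p ≈ A p u * v + (A· x) p
    A·-update {u} v {x} xu≈0 p = begin
      (A· update u v x) p                          ≈⟨ A·-linear 1# split p ⟩
      1# * (A· update u v (λ _ → 0#)) p + (A· x) p ≈⟨ +-congʳ (*-identityˡ _) ⟩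
      (A· update u v (λ _ → 0#)) p + (A· x) p      ≈⟨ +-congʳ (Σ-single n u off-u) ⟩
      A p u * update u v (λ _ → 0#) u + (A· x) p   ≡⟨ cong (λ t → A p u * t + (A· x) p) (update-≡ u v _) ⟩
      A p u * v + (A· x) p                         ∎
      where
      split : ∀ j → update u v x j ≈ 1# * update u v (λ _ → 0#) j + x j
      split j with j ≟ u
      ... | yes refl = sym (trans (+-cong (*-identityˡ v) xu≈0) (+-identityʳ v))
      ... | no _     = sym (trans (+-congʳ (*-identityˡ 0#)) (+-identityˡ (x j)))
      off-u : ∀ j → j ≢ u → A p j * update u v (λ _ → 0#) j ≈ 0#
      off-u j j≢u rewrite update-≢ u v (λ _ → 0#) j≢u = zeroʳ (A p j)

    forcing-row-supportedIn : ∀ {blue p u} → (∀ w → w ∉ blue → w ≢ u → A p w ≈ 0#) →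
                              SupportedIn (A p) (⁅ u ⁆ ∪ blue)
    forcing-row-supportedIn {blue} {u = u} row≈0 w w∉ =
      row≈0 w (proj₂ (∉⁅u⁆∪⁻ u blue w∉)) (proj₁ (∉⁅u⁆∪⁻ u blue w∉))

    forcingFrom-linear : ∀ {blue π} (ch : Chron F A blue π) α {b b₁ b₂ x x₁ x₂ : VecF F n} →
                         (∀ i → b i ≈ α * b₁ i + b₂ i) → (∀ j → x j ≈ α * x₁ j + x₂ j) →
                         ∀ j → forcingFrom F ch b x j ≈
                               α * forcingFrom F ch b₁ x₁ j + forcingFrom F ch b₂ x₂ j
    forcingFrom-linear (done _) α b≈ x≈ = x≈
    forcingFrom-linear (step {p} {u} _ _ nz _ rest) α {b} {b₁} {b₂} {x} {x₁} {x₂} b≈ x≈ =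
      forcingFrom-linear rest α b≈ x′≈
      where
      k = inv (A p u) nz
      value≈ : (b p - (A· x) p) * k ≈ α * ((b₁ p - (A· x₁) p) * k) + (b₂ p - (A· x₂) p) * k
      value≈ = begin
        (b p - (A· x) p) * k
          ≈⟨ *-congʳ (+-cong (b≈ p) (-‿cong (A·-linear α x≈ p))) ⟩
        ((α * b₁ p + b₂ p) - (α * (A· x₁) p + (A· x₂) p)) * k
          ≈⟨ *-congʳ (-‿linear α _ _ _ _) ⟩
        (α * (b₁ p - (A· x₁) p) + (b₂ p - (A· x₂) p)) * k
          ≈⟨ distribʳ k _ _ ⟩
        (α * (b₁ p - (A· x₁) p)) * k + (b₂ p - (A· x₂) p) * k
          ≈⟨ +-congʳ (*-assoc α _ k) ⟩
        α * ((b₁ p - (A· x₁) p) * k) + (b₂ p - (A· x₂) p) * k ∎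
      x′≈ : ∀ j → update u ((b p - (A· x) p) * k) x j ≈
                  α * update u ((b₁ p - (A· x₁) p) * k) x₁ j + update u ((b₂ p - (A· x₂) p) * k) x₂ j
      x′≈ j with j ≟ u
      ... | yes _ = value≈
      ... | no _  = x≈ j

    forcingFrom-∈ : ∀ {blue π} (ch : Chron F A blue π) (b x : VecF F n) →
                    ∀ j → j ∈ blue → forcingFrom F ch b x j ≈ x j
    forcingFrom-∈ (done _) b x j _ = ≈-refl
    forcingFrom-∈ (step {p} {u} _ u∉ _ _ rest) b x j j∈ =
      trans (forcingFrom-∈ rest b _ j (x∈p∪q⁺ (inj₂ j∈)))
            (reflexive (update-≢ u _ x λ { refl → u∉ j∈ }))

    -- Each force recomputes the forced entry of z from row p of A z, since
    -- that row only sees blue entries, already equal to those of z, and u.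
    forcingFrom-A· : ∀ {blue π} (ch : Chron F A blue π) (z x : VecF F n) →
                     (∀ j → j ∈ blue → x j ≈ z j) → SupportedIn x blue →
                     ∀ j → forcingFrom F ch (A· z) x j ≈ z j
    forcingFrom-A· (done all) z x x≈z _ j = x≈z j (all j)
    forcingFrom-A· (step {p} {u} _ u∉ nz row≈0 rest) z x x≈z x⊆blue =
      forcingFrom-A· rest z (update u value x)
        (update-agrees u value≈zu x≈z) (update-supportedIn u value x⊆blue)
      where
      value = ((A· z) p - (A· x) p) * inv (A p u) nz
      A·z≈ : (A· z) p ≈ A p u * z u + (A· x) p
      A·z≈ = begin
        (A· z) p                   ≈⟨ A·-cong-on (forcing-row-supportedIn row≈0)
                                        (update-agrees u ≈-refl x≈z) ⟨
        (A· update u (z u) x) p    ≈⟨ A·-update (z u) (x⊆blue u u∉) p ⟩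
        A p u * z u + (A· x) p     ∎
      value≈zu : value ≈ z u
      value≈zu = begin
        value                                     ≈⟨ *-congʳ (+-congʳ A·z≈) ⟩
        ((A p u * z u + (A· x) p) - (A· x) p) * _ ≈⟨ *-congʳ (//-rightDividesʳ _ _) ⟩
        (A p u * z u) * inv (A p u) nz            ≈⟨ [x*y]*x⁻¹≈y (A p u) (z u) nz ⟩
        z u                                       ∎

    A·forcingFrom-row : ∀ {blue π} (ch : Chron F A blue π) (p : Fin n) (b x : VecF F n) →
                        SupportedIn (A p) blue → (A· x) p ≈ b p → (A· forcingFrom F ch b x) p ≈ b p
    A·forcingFrom-row (done _) p b x _ row-solved = row-solved
    A·forcingFrom-row {blue} (step {_} {u} _ u∉ _ _ rest) p b x row⊆blue row-solved =
      A·forcingFrom-row rest p b _ (supportedIn-∪ u row⊆blue)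
        (trans (A·-cong-on row⊆blue unchanged-on-blue) row-solved)
      where
      unchanged-on-blue : ∀ j → j ∈ blue → update u _ x j ≈ x j
      unchanged-on-blue j j∈ = reflexive (update-≢ u _ x λ { refl → u∉ j∈ })

    A·forcingFrom-parent : ∀ {blue π} (ch : Chron F A blue π) (b x : VecF F n) → SupportedIn x blue →
                           ∀ p → p List.∈ map proj₁ π → (A· forcingFrom F ch b x) p ≈ b p
    A·forcingFrom-parent (step {p} {u} _ u∉ nz row≈0 rest) b x x⊆blue .p (here refl) =
      A·forcingFrom-row rest p b _ (forcing-row-supportedIn row≈0) row-p-solved
      where
      Ax = (A· x) p
      row-p-solved : (A· update u ((b p - Ax) * inv (A p u) nz) x) p ≈ b p
      row-p-solved = begin
        (A· update u ((b p - Ax) * inv (A p u) nz) x) p ≈⟨ A·-update _ (x⊆blue u u∉) p ⟩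
        A p u * ((b p - Ax) * inv (A p u) nz) + Ax      ≈⟨ +-congʳ (x*[y*x⁻¹]≈y (A p u) (b p - Ax) nz) ⟩
        (b p - Ax) + Ax                                 ≈⟨ //-rightDividesˡ Ax (b p) ⟩
        b p                                             ∎
    A·forcingFrom-parent (step {p} {u} _ _ _ _ rest) b x x⊆blue q (there q∈) =
      A·forcingFrom-parent rest b _ (update-supportedIn u _ x⊆blue) q q∈

    module _ {Z : Subset n} {π : List (Fin n × Fin n)} (ch : Chron F A Z π) where

      R = Res F ch

      Res-linear : ∀ α {b b₁ b₂ : VecF F n} → (∀ i → b i ≈ α * b₁ i + b₂ i) →
                   ∀ v → R b v ≈ α * R b₁ v + R b₂ v
      Res-linear α b≈ v =
        trans (+-cong (b≈ v) (-‿cong (A·-linear α (forcingFrom-linear ch α b≈ (λ _ → 0≈α*0+0 α)) v)))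
              (-‿linear α _ _ _ _)

      Res-zero : ∀ v → R (λ _ → 0#) v ≈ 0#
      Res-zero v = trans (Res-linear (- 1#) (λ _ → 0≈α*0+0 (- 1#)) v) (-1*x+x≈0 _)

      Res-cong : ∀ {b b′ : VecF F n} → (∀ i → b i ≈ b′ i) → ∀ v → R b v ≈ R b′ v
      Res-cong b≈b′ v =
        trans (Res-linear 0# (λ i → trans (b≈b′ i) (sym 0*x+x≈x)) v) 0*x+x≈x
        where
        0*x+x≈x : ∀ {x} → 0# * x + x ≈ x
        0*x+x≈x = trans (+-congʳ (zeroˡ _)) (+-identityˡ _)

      Res-scale : ∀ α (b : VecF F n) v → R (λ i → α * b i) v ≈ α * R b v
      Res-scale α b v =
        trans (Res-linear α (λ i → sym (+-identityʳ _)) v)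
              (trans (+-congˡ (Res-zero v)) (+-identityʳ _))

      Res-sub : ∀ (b b′ : VecF F n) v → R (λ i → b i - b′ i) v ≈ R b v - R b′ v
      Res-sub b b′ v = begin
        R (λ i → b i - b′ i) v ≈⟨ Res-linear (- 1#) b-b′≈ v ⟩
        - 1# * R b′ v + R b v  ≈⟨ trans (+-congʳ (-1*x≈-x _)) (+-comm _ _) ⟩
        R b v - R b′ v         ∎
        where
        b-b′≈ : ∀ i → b i - b′ i ≈ - 1# * b′ i + b i
        b-b′≈ i = trans (+-comm _ _) (+-congʳ (sym (-1*x≈-x _)))

      Res-Σ : ∀ m (g : Fin m → VecF F n) v → R (λ i → Σ F m (λ w → g w i)) v ≈ Σ F m (λ w → R (g w) v)
      Res-Σ zero    g v = Res-zero v
      Res-Σ (suc m) g v =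
        trans (Res-linear 1# (λ i → +-congʳ (sym (*-identityˡ _))) v)
              (+-cong (*-identityˡ _) (Res-Σ m (g ∘ suc) v))

      Res-A·restrict : ∀ y v → R (A· restrict Z y) v ≈ coreMul F ch y v
      Res-A·restrict y v =
        trans (Res-Σ n (λ w i → A i w * restrict Z y w) v) (Σ-cong n (λ w → column w (lookup Z w)))
        where
        column : ∀ w β → R (λ i → A i w * (if β then y w else 0#)) v ≈
                         (if β then core F ch v w * y w else 0#)
        column w true  = trans (Res-cong (λ i → *-comm _ _) v) (trans (Res-scale (y w) _ v) (*-comm _ _))
        column w false = trans (Res-cong (λ i → zeroʳ _) v) (Res-zero v)

      Res-parent : ∀ b p → p List.∈ map proj₁ π → R b p ≈ 0#
      Res-parent b p p∈ = x≈y⇒x∙y⁻¹≈ε (sym (A·forcingFrom-parent ch b (λ _ → 0#) (λ _ _ → ≈-refl) p p∈))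

      forcingFrom-split : ∀ (b x₀ : VecF F n) → SupportedIn x₀ Z →
                          ∀ j → forcingFrom F ch b x₀ j ≈ x₀ j + Forcing F ch (λ i → b i - (A· x₀) i) j
      forcingFrom-split b x₀ x₀⊆Z j =
        trans (forcingFrom-linear ch 1# b≈ (λ j → x≈1*x+0 (x₀ j)) j)
              (+-congʳ (trans (*-identityˡ _) (forcingFrom-A· ch x₀ x₀ (λ _ _ → ≈-refl) x₀⊆Z j)))
        where
        b≈ : ∀ i → b i ≈ 1# * (A· x₀) i + (b i - (A· x₀) i)
        b≈ i = trans (sym (//-rightDividesˡ _ (b i)))
                     (trans (+-comm _ _) (+-congʳ (sym (*-identityˡ _))))

      forcingFrom-solves : ∀ (b x₀ : VecF F n) → SupportedIn x₀ Z →
                           (∀ i → R (λ i → b i - (A· x₀) i) i ≈ 0#) →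
                           ∀ i → (A· forcingFrom F ch b x₀) i ≈ b i
      forcingFrom-solves b x₀ x₀⊆Z R≈0 i = begin
        (A· forcingFrom F ch b x₀) i           ≈⟨ A·-linear 1# split i ⟩
        1# * (A· x₀) i + (A· Forcing F ch d) i ≈⟨ +-cong (*-identityˡ _) (sym (x∙y⁻¹≈ε⇒x≈y _ _ (R≈0 i))) ⟩
        (A· x₀) i + (b i - (A· x₀) i)          ≈⟨ trans (+-comm _ _) (//-rightDividesˡ _ (b i)) ⟩
        b i                                    ∎
        where
        d = λ i → b i - (A· x₀) i
        split : ∀ j → forcingFrom F ch b x₀ j ≈ 1# * x₀ j + Forcing F ch d j
        split j = trans (forcingFrom-split b x₀ x₀⊆Z j) (+-congʳ (sym (*-identityˡ _)))

      core-equation⇒residual≈0 : ∀ b y → (∀ v → Terminal F π v → coreMul F ch y v ≈ R b v) →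
                                 ∀ v → R (λ i → b i - (A· restrict Z y) i) v ≈ 0#
      core-equation⇒residual≈0 b y By≈Rb v with v ∈ₗ? map proj₁ π
      ... | yes parent  = Res-parent _ v parent
      ... | no terminal = trans (Res-sub b (A· restrict Z y) v)
          (x≈y⇒x∙y⁻¹≈ε (trans (sym (By≈Rb v terminal)) (sym (Res-A·restrict y v))))

theorem5 : {c ℓ : Level} (F : Field c ℓ) (n : ℕ) (A : Matrix F n) (Z : Subset n)
    (π : List (Fin n × Fin n)) (ch : Chron F A Z π) (b : VecF F n)
    → (∃ λ x → ∀ i → Field._≈_ F (mulV F A x i) (b i))
    → (y : VecF F n)
    → (∀ v → Terminal F π v → Field._≈_ F (coreMul F ch y v) (Res F ch b v))
    → ∃ λ x → (∀ i → Field._≈_ F (mulV F A x i) (b i))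
    × (∀ w → w ∈ Z → Field._≈_ F (x w) (y w))
theorem5 F n A Z π ch b _ y By≈Rb =
  forcingFrom F ch b y₀ ,
  forcingFrom-solves A ch b y₀ (restrict-supportedIn Z y) (core-equation⇒residual≈0 A ch b y By≈Rb) ,
  λ w w∈Z → trans (forcingFrom-∈ A ch b y₀ w w∈Z) (restrict-∈ y w∈Z)
  where
  open Field F using (trans)
  open Properties F
  y₀ = restrict Z y
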